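{- The Paley oriented two-graph $g_3$ is special, and $\operatorname{Aut}(g_3)\cong\operatorname{PSL}_2(\mathbb{F}_3)$.
   Context: For a tournament $T$ with $e_T(x,y)=1$ if $(x,y)$ is an edge and $-1$ otherwise, $g_T(x,y,z)=e_T(x,y)e_T(y,z)e_T(z,x)$. $g_3=g_{T^+}$, where $T$ is the cyclic tournament on $\mathbb{F}_3=\{0,1,2\}$ with edges $0\to1\to2\to0$ (i.e. $(x,y)$ an edge iff $y-x$ is a nonzero square in $\mathbb{F}_3$), and $T^+$ adds a new vertex $\infty$ with $(x,\infty)$ an edge for every $x$. An oriented two-graph on $V$ is an alternating $\{\pm1\}$-valued function on ordered triples of distinct elements satisfying $g(x,y,z)g(y,x,w)g(z,y,w)g(x,z,w)=1$ for distinct $x,y,z,w$; restriction $h|_A$ and isomorphism (via a bijection preserving the function) are as usual; $\operatorname{Aut}(g)$ is the group of permutations preserving $g$. An oriented two-graph $g$ on $r$ vertices is special if for every oriented two-graph $h$ on a set $V$ with $|V|=r+1$, the number of subsets $A\subset V$ with $h|_A\cong g$ is at most $2$. -}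

module Defs where

open import Data.Nat using (ℕ; suc; _+_; _*_; _∸_)
open import Data.Nat.DivMod using (_mod_)
open import Data.Fin using (Fin; zero; suc; toℕ)
open import Data.Fin.Subset using (Subset; _∈_)
open import Data.Fin.Permutation using (Permutation′; _⟨$⟩ʳ_; _∘ₚ_)
open import Data.Sign using (Sign; opposite) renaming (_*_ to _·_; + to ⊕; - to ⊖)
open import Data.Maybe using (Maybe; just; nothing)
open import Function.Bundles using (Injection)
open import Function.Properties.Inverse using (↔⇒↣)
open import Data.Bool using (Bool; true; false; if_then_else_; _∨_)
open import Data.Product using (Σ; _×_; _,_; ∃; proj₁)
open import Data.Sum using (_⊎_)
open import Relation.Binary.PropositionalEquality using (_≡_; _≢_; trans)
open import Relation.Nullary.Decidable using (⌊_⌋)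
open import Function.Definitions using (Injective)
import Data.Fin as F

-- Oriented two-graphs on a finite vertex set Fin n.
-- Values ±1 are represented by Data.Sign (⊕ = +1, ⊖ = -1).
-- The function is only constrained on triples of distinct elements.

Distinct3 : ∀ {n} → Fin n → Fin n → Fin n → Set
Distinct3 x y z = x ≢ y × y ≢ z × x ≢ z

Distinct4 : ∀ {n} → Fin n → Fin n → Fin n → Fin n → Set
Distinct4 x y z w = Distinct3 x y z × x ≢ w × y ≢ w × z ≢ w

Ternary : ℕ → Set
Ternary n = Fin n → Fin n → Fin n → Sign

Alternating : ∀ {n} → Ternary n → Set
Alternating {n} g = ∀ (x y z : Fin n) → Distinct3 x y z →
  (g y x z ≡ opposite (g x y z)) × (g x z y ≡ opposite (g x y z))
  × (g z y x ≡ opposite (g x y z))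

Cocycle : ∀ {n} → Ternary n → Set
Cocycle {n} g = ∀ (x y z w : Fin n) → Distinct4 x y z w →
  g x y z · g y x w · g z y w · g x z w ≡ ⊕

record OrientedTwoGraph (n : ℕ) : Set where
  field
    fun         : Ternary n
    alternating : Alternating fun
    cocycle     : Cocycle fun
open OrientedTwoGraph public

-- h|_A ≅ g, for h on Fin n, A ⊆ Fin n, g on Fin r:
-- a bijection f : Fin r → A (injective, lands in A, onto A) preserving the functions.
RestrictIso : ∀ {n r} → Ternary n → Subset n → Ternary r → Set
RestrictIso {n} {r} h A g = Σ (Fin r → Fin n) λ f →
  Injective _≡_ _≡_ f × (∀ i → f i ∈ A) × (∀ v → v ∈ A → ∃ λ i → f i ≡ v)
  × (∀ x y z → Distinct3 x y z → h (f x) (f y) (f z) ≡ g x y z)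

AtMostTwo : ∀ {n} → (Subset n → Set) → Set
AtMostTwo {n} P = ∀ (A B C : Subset n) → P A → P B → P C →
  A ≡ B ⊎ A ≡ C ⊎ B ≡ C

Special : ∀ {r} → Ternary r → Set
Special {r} g = ∀ (h : OrientedTwoGraph (suc r)) → AtMostTwo (λ A → RestrictIso (fun h) A g)

-- The Paley oriented two-graph g₃.
-- Vertices Fin 4: 0,1,2 are the elements of 𝔽₃, and 3 is ∞.

_-₃_ : Fin 3 → Fin 3 → Fin 3
a -₃ b = (toℕ a + (3 ∸ toℕ b)) mod 3

_*₃_ : Fin 3 → Fin 3 → Fin 3
a *₃ b = (toℕ a * toℕ b) mod 3

isNZSquare : Fin 3 → Bool
isNZSquare d = ⌊ (suc zero *₃ suc zero) F.≟ d ⌋ ∨ ⌊ (suc (suc zero) *₃ suc (suc zero)) F.≟ d ⌋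

fromBool : Bool → Sign
fromBool true = ⊕
fromBool false = ⊖

vtx : Fin 4 → Maybe (Fin 3)
vtx zero = just zero
vtx (suc zero) = just (suc zero)
vtx (suc (suc zero)) = just (suc (suc zero))
vtx (suc (suc (suc zero))) = nothing

-- e_{T⁺}: T on 𝔽₃ has edge x→y iff y-x is a nonzero square in 𝔽₃;
-- T⁺ adds ∞ with x→∞ an edge for all x ∈ 𝔽₃.  (Values for x = y are irrelevant.)
eT⁺ : Maybe (Fin 3) → Maybe (Fin 3) → Sign
eT⁺ (just x) (just y) = fromBool (isNZSquare (y -₃ x))
eT⁺ (just x) nothing = ⊕
eT⁺ nothing _ = ⊖

e₃ : Fin 4 → Fin 4 → Sign
e₃ x y = eT⁺ (vtx x) (vtx y)

g₃ : Ternary 4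
g₃ x y z = e₃ x y · e₃ y z · e₃ z x

Preserves : ∀ {n} → Ternary n → Permutation′ n → Set
Preserves {n} g π = ∀ (x y z : Fin n) → Distinct3 x y z →
  g (π ⟨$⟩ʳ x) (π ⟨$⟩ʳ y) (π ⟨$⟩ʳ z) ≡ g x y z

Aut : ∀ {n} → Ternary n → Set
Aut {n} g = Σ (Permutation′ n) (Preserves g)

_≈Aut_ : ∀ {n} {g : Ternary n} → Aut g → Aut g → Set
_≈Aut_ {n} (π , _) (σ , _) = ∀ (i : Fin n) → π ⟨$⟩ʳ i ≡ σ ⟨$⟩ʳ i

perm-distinct : ∀ {n} (π : Permutation′ n) {x y z : Fin n} → Distinct3 x y z →
  Distinct3 (π ⟨$⟩ʳ x) (π ⟨$⟩ʳ y) (π ⟨$⟩ʳ z)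
perm-distinct π (a , b , c) =
  (λ e → a (Injection.injective (↔⇒↣ π) e)) , (λ e → b (Injection.injective (↔⇒↣ π) e)) , (λ e → c (Injection.injective (↔⇒↣ π) e))

-- group operation of Aut(g): composition of permutations (π first, then σ)
_∘Aut_ : ∀ {n} {g : Ternary n} → Aut g → Aut g → Aut g
(π , pπ) ∘Aut (σ , pσ) = (π ∘ₚ σ) , λ x y z d →
  trans (pσ _ _ _ (perm-distinct π d)) (pπ x y z d)

_+₃_ : Fin 3 → Fin 3 → Fin 3
a +₃ b = (toℕ a + toℕ b) mod 3

neg₃ : Fin 3 → Fin 3
neg₃ a = zero -₃ a

record Mat : Set where
  constructor mat
  field a b c d : Fin 3

det : Mat → Fin 3
det (mat a b c d) = (a *₃ d) -₃ (b *₃ c)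

_⊗_ : Mat → Mat → Mat
mat a b c d ⊗ mat a' b' c' d' =
  mat ((a *₃ a') +₃ (b *₃ c')) ((a *₃ b') +₃ (b *₃ d'))
      ((c *₃ a') +₃ (d *₃ c')) ((c *₃ b') +₃ (d *₃ d'))

negM : Mat → Mat
negM (mat a b c d) = mat (neg₃ a) (neg₃ b) (neg₃ c) (neg₃ d)

SL₂𝔽₃ : Set
SL₂𝔽₃ = Σ Mat (λ M → det M ≡ suc zero)

_≈±_ : Mat → Mat → Set
M ≈± N = M ≡ N ⊎ M ≡ negM N

-- Group isomorphism Aut(g) ≅ PSL₂(𝔽₃), PSL₂(𝔽₃) presented as SL₂(𝔽₃)
-- modulo ±I: a map φ which respects the equalities, is injective and
-- surjective modulo them, and is multiplicative.

IsoToPSL₂𝔽₃ : ∀ {n} {g : Ternary n} → (Aut g → SL₂𝔽₃) → Set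
IsoToPSL₂𝔽₃ {n} {g} φ =
    (∀ (α β : Aut g) → α ≈Aut β → proj₁ (φ α) ≈± proj₁ (φ β))
  × (∀ (α β : Aut g) → proj₁ (φ α) ≈± proj₁ (φ β) → α ≈Aut β)
  × (∀ (M : SL₂𝔽₃) → ∃ λ (α : Aut g) → proj₁ (φ α) ≈± proj₁ M)
  × (∀ (α β : Aut g) → proj₁ (φ (α ∘Aut β)) ≈± (proj₁ (φ α) ⊗ proj₁ (φ β)))

AutIsoPSL₂𝔽₃ : ∀ {n} → Ternary n → Set
AutIsoPSL₂𝔽₃ g = Σ (Aut g → SL₂𝔽₃) IsoToPSL₂𝔽₃

module Submission where

-- g₃ splits pairs: for distinct x, y, z, w we have g₃(x,y,z) = −g₃(x,y,w). In a ternary function h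
-- on five points every copy of g₃ sits on the complement of a single point. If the complements of
-- three distinct points a, b, c carried copies, then for the two remaining points p, q the signs
-- h(p,q,a), h(p,q,b), h(p,q,c) would be pairwise opposite, which is impossible.
--
-- SL₂(𝔽₃) acts on 𝔽₃ ∪ {∞} by Möbius transformations; they preserve g₃, the kernel of the action
-- is ±I, and an exhaustive search shows that every automorphism of g₃ is a Möbius transformation.
-- Sending an automorphism to a matrix inducing it is therefore an isomorphism onto PSL₂(𝔽₃).

open import Defs
open import Data.Nat using (suc)
open import Data.Nat.Properties using (1+n≰n)
open import Data.Product using (_×_; _,_; proj₁; proj₂; ∃; ∃₂; map₂)
open import Data.Maybe using (Maybe; just; nothing)
open import Data.Vec using (Vec; _∷_; []; lookup; tabulate)
open import Data.Vec.Properties using (lookup∘tabulate)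
open import Data.Fin.Permutation using (_⟨$⟩ʳ_; permutation)
open import Data.Sum using (inj₁; inj₂)
open import Data.Empty using (⊥; ⊥-elim)
open import Data.Fin using (Fin; zero; suc; punchOut; inject₁)
open import Data.Fin.Properties using (_≟_; all?; any?; ¬∀⟶∃¬; injective⇒≤; punchOut-injective)
open import Data.Fin.Subset using (Subset; _∈_; _∉_; ∁; ⁅_⁆)
open import Data.Fin.Subset.Properties using (_∈?_; ⊆-antisym; x∈∁p⇒x∉p; x∉p⇒x∈∁p; x≢y⇒x∉⁅y⁆; x∈⁅x⁆)
open import Data.Sign using (Sign; opposite)
import Data.Sign.Properties as Sign
open import Function.Definitions using (Injective)
open import Relation.Binary.PropositionalEquality using (_≡_; _≢_; refl; sym; trans; cong; cong₂; module ≡-Reasoning)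
open import Relation.Nullary using (yes; no; contradiction)
open import Relation.Nullary.Decidable using (Dec; map′; ¬?; _×-dec_; _⊎-dec_; _→-dec_; from-yes)

Distinct5 : ∀ {n} → Fin n → Fin n → Fin n → Fin n → Fin n → Set
Distinct5 x y z w v = Distinct4 x y z w × x ≢ v × y ≢ v × z ≢ v × w ≢ v

distinct3? : ∀ {n} (x y z : Fin n) → Dec (Distinct3 x y z)
distinct3? x y z = ¬? (x ≟ y) ×-dec ¬? (y ≟ z) ×-dec ¬? (x ≟ z)

distinct4? : ∀ {n} (x y z w : Fin n) → Dec (Distinct4 x y z w)
distinct4? x y z w = distinct3? x y z ×-dec ¬? (x ≟ w) ×-dec ¬? (y ≟ w) ×-dec ¬? (z ≟ w)

distinct5? : ∀ {n} (x y z w v : Fin n) → Dec (Distinct5 x y z w v)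
distinct5? x y z w v = distinct4? x y z w ×-dec ¬? (x ≟ v) ×-dec ¬? (y ≟ v) ×-dec ¬? (z ≟ v) ×-dec ¬? (w ≟ v)

Splitting : ∀ {n} → Ternary n → Set
Splitting g = ∀ x y z w → Distinct4 x y z w → g x y z ≡ opposite (g x y w)

g₃-splitting : Splitting g₃
g₃-splitting = from-yes (all? λ x → all? λ y → all? λ z → all? λ w →
  distinct4? x y z w →-dec (g₃ x y z Sign.≟ opposite (g₃ x y w)))

restrictIso-splitting : ∀ {n r} {h : Ternary n} {A : Subset n} {g : Ternary r} →
  RestrictIso h A g → Splitting g →
  ∀ {p q x y} → Distinct4 p q x y → p ∈ A → q ∈ A → x ∈ A → y ∈ A → h p q x ≡ opposite (h p q y)
restrictIso-splitting {h = h} {g = g} (f , _ , _ , onto , f-pres) split d p∈A q∈A x∈A y∈A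
  with onto _ p∈A | onto _ q∈A | onto _ x∈A | onto _ y∈A | d
... | i , refl | j , refl | k , refl | l , refl | ((i≢j , j≢k , i≢k) , i≢l , j≢l , k≢l) = begin
  h (f i) (f j) (f k)             ≡⟨ f-pres i j k (pre i≢j , pre j≢k , pre i≢k) ⟩
  g i j k                         ≡⟨ split i j k l ((pre i≢j , pre j≢k , pre i≢k) , pre i≢l , pre j≢l , pre k≢l) ⟩
  opposite (g i j l)              ≡⟨ cong opposite (sym (f-pres i j l (pre i≢j , pre j≢l , pre i≢l))) ⟩
  opposite (h (f i) (f j) (f l))  ∎
  where
  open ≡-Reasoning
  pre : ∀ {a b} → f a ≢ f b → a ≢ b
  pre fa≢fb a≡b = fa≢fb (cong f a≡b)

punchOut∘-injective : ∀ {n k} {f : Fin n → Fin (suc k)} → Injective _≡_ _≡_ f →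
  ∀ {m} (m∉f : ∀ i → m ≢ f i) → Injective _≡_ _≡_ (λ i → punchOut (m∉f i))
punchOut∘-injective f-inj m∉f e = f-inj (punchOut-injective (m∉f _) (m∉f _) e)

injective⇒surjective : ∀ {n} (f : Fin n → Fin n) → Injective _≡_ _≡_ f → ∀ v → ∃ λ i → f i ≡ v
injective⇒surjective {suc n} f f-inj v with any? (λ i → f i ≟ v)
... | yes hit = hit
... | no miss = contradiction (injective⇒≤ (punchOut∘-injective f-inj λ i v≡fi → miss (i , sym v≡fi))) 1+n≰n

injection-misses-one : ∀ {n} {f : Fin n → Fin (suc n)} → Injective _≡_ _≡_ f →
  ∀ {m v} → (∀ i → m ≢ f i) → (∀ i → v ≢ f i) → m ≡ v
injection-misses-one f-inj {m} {v} m∉f v∉f with m ≟ v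
... | yes m≡v = m≡v
... | no m≢v with injective⇒surjective _ (punchOut∘-injective f-inj m∉f) (punchOut m≢v)
...   | i , e = ⊥-elim (v∉f i (sym (punchOut-injective (m∉f i) m≢v e)))

image≡∁⁅missing⁆ : ∀ {n} {f : Fin n → Fin (suc n)} {A : Subset (suc n)} → Injective _≡_ _≡_ f →
  (∀ i → f i ∈ A) → (∀ v → v ∈ A → ∃ λ i → f i ≡ v) → ∃ λ m → A ≡ ∁ ⁅ m ⁆
image≡∁⁅missing⁆ {n} {f} {A} f-inj f∈A onto = m , ⊆-antisym A⊆∁⁅m⁆ ∁⁅m⁆⊆A
  where
  ∉image : ∀ {v} → v ∉ A → ∀ i → v ≢ f i
  ∉image v∉A i refl = v∉A (f∈A i)
  preimage-injective : (all∈A : ∀ v → v ∈ A) → Injective _≡_ _≡_ (λ v → proj₁ (onto v (all∈A v)))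
  preimage-injective all∈A {v} {w} e = trans (sym (proj₂ (onto v _))) (trans (cong f e) (proj₂ (onto w _)))
  missing : ∃ λ m → m ∉ A
  missing = ¬∀⟶∃¬ (suc n) (_∈ A) (_∈? A) λ all∈A → 1+n≰n (injective⇒≤ (preimage-injective all∈A))
  m = proj₁ missing
  A⊆∁⁅m⁆ : ∀ {v} → v ∈ A → v ∈ ∁ ⁅ m ⁆
  A⊆∁⁅m⁆ v∈A = x∉p⇒x∈∁p (x≢y⇒x∉⁅y⁆ λ { refl → proj₂ missing v∈A })
  ∁⁅m⁆⊆A : ∀ {v} → v ∈ ∁ ⁅ m ⁆ → v ∈ A
  ∁⁅m⁆⊆A {v} v∈∁⁅m⁆ with v ∈? A
  ... | yes v∈A = v∈A
  ... | no v∉A with injection-misses-one f-inj (∉image (proj₂ missing)) (∉image v∉A)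
  ...   | refl = contradiction (x∈⁅x⁆ v) (x∈∁p⇒x∉p v∈∁⁅m⁆)

punctured : ∀ {r} {h : Ternary (suc r)} {A : Subset (suc r)} {g : Ternary r} →
  RestrictIso h A g → ∃ λ m → A ≡ ∁ ⁅ m ⁆
punctured (_ , f-inj , f∈A , onto , _) = image≡∁⁅missing⁆ f-inj f∈A onto

two-points-off-three : ∀ (a b c : Fin 5) → Distinct3 a b c →
  ∃₂ λ p q → Distinct5 p q b c a × Distinct5 p q a c b × Distinct5 p q a b c
two-points-off-three = from-yes (all? λ (a : Fin 5) → all? λ b → all? λ c → distinct3? a b c →-dec
  (any? λ p → any? λ q → distinct5? p q b c a ×-dec distinct5? p q a c b ×-dec distinct5? p q a b c))

pairwise-opposite-impossible : ∀ {s t u : Sign} → s ≡ opposite t → s ≡ opposite u → t ≡ opposite u → ⊥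
pairwise-opposite-impossible {t = t} s≡-t s≡-u t≡-u =
  Sign.s≢opposite[s] t (trans t≡-u (cong opposite (sym (Sign.opposite-injective (trans (sym s≡-t) s≡-u)))))

no-three-punctured-copies : ∀ {g : Ternary 4} {h : Ternary 5} → Splitting g → ∀ {a b c} → Distinct3 a b c →
  RestrictIso h (∁ ⁅ a ⁆) g → RestrictIso h (∁ ⁅ b ⁆) g → RestrictIso h (∁ ⁅ c ⁆) g → ⊥
no-three-punctured-copies {g} {h} split {a} {b} {c} abc isoA isoB isoC = contradict (two-points-off-three a b c abc)
  where
  split-off : ∀ {m p q x y} → RestrictIso h (∁ ⁅ m ⁆) g → Distinct5 p q x y m → h p q x ≡ opposite (h p q y)
  split-off iso (d , p≢m , q≢m , x≢m , y≢m) =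
    restrictIso-splitting iso split d (off p≢m) (off q≢m) (off x≢m) (off y≢m)
    where
    off : ∀ {v m} → v ≢ m → v ∈ ∁ ⁅ m ⁆
    off v≢m = x∉p⇒x∈∁p (x≢y⇒x∉⁅y⁆ v≢m)
  contradict : (∃₂ λ p q → Distinct5 p q b c a × Distinct5 p q a c b × Distinct5 p q a b c) → ⊥
  contradict (p , q , off-a , off-b , off-c) =
    pairwise-opposite-impossible (split-off isoC off-c) (split-off isoB off-b) (split-off isoA off-a)

splitting⇒special : {g : Ternary 4} → Splitting g → Special g
splitting⇒special split h A B C isoA isoB isoC
  with punctured {h = fun h} isoA | punctured {h = fun h} isoB | punctured {h = fun h} isoC
... | a , refl | b , refl | c , refl with a ≟ b | a ≟ c | b ≟ c
...   | yes refl | _        | _        = inj₁ refl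
...   | no _     | yes refl | _        = inj₂ (inj₁ refl)
...   | no _     | no _     | yes refl = inj₂ (inj₂ refl)
...   | no a≢b   | no a≢c   | no b≢c   =
  ⊥-elim (no-three-punctured-copies {h = fun h} split (a≢b , b≢c , a≢c) isoA isoB isoC)

_≟ₘ_ : (M N : Mat) → Dec (M ≡ N)
mat a b c d ≟ₘ mat a′ b′ c′ d′ =
  map′ (λ { (refl , refl , refl , refl) → refl }) (λ { refl → refl , refl , refl , refl })
       (a ≟ a′ ×-dec b ≟ b′ ×-dec c ≟ c′ ×-dec d ≟ d′)

∀-Mat? : {P : Mat → Set} → (∀ M → Dec (P M)) → Dec (∀ M → P M)
∀-Mat? P? = map′ (λ h → λ { (mat a b c d) → h a b c d }) (λ h a b c d → h (mat a b c d))
  (all? λ a → all? λ b → all? λ c → all? λ d → P? (mat a b c d))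

∀-SL₂? : {P : Mat → Set} → (∀ M → Dec (P M)) → Dec (∀ M → det M ≡ suc zero → P M)
∀-SL₂? P? = ∀-Mat? λ M → det M ≟ suc zero →-dec P? M

∃-SL₂? : {P : Mat → Set} → (∀ M → Dec (P M)) → Dec (∃ λ M → det M ≡ suc zero × P M)
∃-SL₂? P? = map′ (λ { (a , b , c , d , p) → mat a b c d , p }) (λ { (mat a b c d , p) → a , b , c , d , p })
  (any? λ a → any? λ b → any? λ c → any? λ d → det (mat a b c d) ≟ suc zero ×-dec P? (mat a b c d))

det-⊗ : ∀ M N → det (M ⊗ N) ≡ det M *₃ det N
det-⊗ = from-yes (∀-Mat? λ M → ∀-Mat? λ N → det (M ⊗ N) ≟ det M *₃ det N)

-- Homogeneous coordinates on the projective line 𝔽₃ ∪ {∞}: x ↦ [x : 1], ∞ ↦ [1 : 0].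
hom : Maybe (Fin 3) → Fin 3 × Fin 3
hom (just x) = x , suc zero
hom nothing  = suc zero , zero

-- [u : v] ↦ u/v, computed as u · v since v² = 1 for v ≠ 0 in 𝔽₃; the junk value
-- [0 : 0] ↦ ∞ only arises for singular matrices.
dehom : Fin 3 × Fin 3 → Fin 4
dehom (u , zero)      = suc (suc (suc zero))
dehom (u , v@(suc _)) = inject₁ (u *₃ v)

_·ᵥ_ : Fin 3 × Fin 3 → Mat → Fin 3 × Fin 3
(u , v) ·ᵥ mat a b c d = (u *₃ a) +₃ (v *₃ c) , (u *₃ b) +₃ (v *₃ d)

-- The right action of matrices on 𝔽₃ ∪ {∞} by Möbius transformations x ↦ (ax + c)/(bx + d).
_⋆_ : Fin 4 → Mat → Fin 4
x ⋆ M = dehom (hom (vtx x) ·ᵥ M)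

⋆-⊗ : ∀ M → det M ≡ suc zero → ∀ N → det N ≡ suc zero → ∀ x → x ⋆ (M ⊗ N) ≡ (x ⋆ M) ⋆ N
⋆-⊗ = from-yes (∀-SL₂? λ M → ∀-SL₂? λ N → all? λ x → x ⋆ (M ⊗ N) ≟ (x ⋆ M) ⋆ N)

⋆-negM : ∀ M x → x ⋆ negM M ≡ x ⋆ M
⋆-negM = from-yes (∀-Mat? λ M → all? λ x → x ⋆ negM M ≟ x ⋆ M)

⋆-kernel : ∀ (M N : SL₂𝔽₃) → (∀ x → x ⋆ proj₁ M ≡ x ⋆ proj₁ N) → proj₁ M ≈± proj₁ N
⋆-kernel (M , det≡1) (N , det′≡1) = kernel M det≡1 N det′≡1
  where
  kernel : ∀ M → det M ≡ suc zero → ∀ N → det N ≡ suc zero → (∀ x → x ⋆ M ≡ x ⋆ N) → M ≈± N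
  kernel = from-yes (∀-SL₂? λ M → ∀-SL₂? λ N →
    (all? λ x → x ⋆ M ≟ x ⋆ N) →-dec (M ≟ₘ N ⊎-dec M ≟ₘ negM N))

adj : Mat → Mat
adj (mat a b c d) = mat d (neg₃ b) (neg₃ c) a

⋆-adj : ∀ M → det M ≡ suc zero → ∀ x → (x ⋆ M) ⋆ adj M ≡ x × (x ⋆ adj M) ⋆ M ≡ x
⋆-adj = from-yes (∀-SL₂? λ M → all? λ x → (x ⋆ M) ⋆ adj M ≟ x ×-dec (x ⋆ adj M) ⋆ M ≟ x)

IsEndomorphism : ∀ {n} → Ternary n → (Fin n → Fin n) → Set
IsEndomorphism g f = ∀ x y z → Distinct3 x y z → g (f x) (f y) (f z) ≡ g x y z

⋆-endomorphism : ∀ M → det M ≡ suc zero → IsEndomorphism g₃ (_⋆ M)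
⋆-endomorphism = from-yes (∀-SL₂? λ M → all? λ x → all? λ y → all? λ z →
  distinct3? x y z →-dec (g₃ (x ⋆ M) (y ⋆ M) (z ⋆ M) Sign.≟ g₃ x y z))

isEndomorphism-resp-≗ : ∀ {n} {g : Ternary n} {f f′ : Fin n → Fin n} → (∀ x → f x ≡ f′ x) →
  IsEndomorphism g f → IsEndomorphism g f′
isEndomorphism-resp-≗ f≗f′ f-endo x y z d
  rewrite sym (f≗f′ x) | sym (f≗f′ y) | sym (f≗f′ z) = f-endo x y z d

-- Opaque so that uses of φ never unfold the witness, which would rerun the exhaustive search.
opaque
  endomorphism-möbius : ∀ (f : Fin 4 → Fin 4) → IsEndomorphism g₃ f →
    ∃ λ M → det M ≡ suc zero × ∀ x → f x ≡ x ⋆ M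
  endomorphism-möbius f f-endo =
    map₂ (map₂ λ agree x → trans (sym (lookup∘tabulate f x)) (agree x))
         (tabulated (tabulate f) (isEndomorphism-resp-≗ (λ x → sym (lookup∘tabulate f x)) f-endo))
    where
    tabulated : ∀ (v : Vec (Fin 4) 4) → IsEndomorphism g₃ (lookup v) →
      ∃ λ M → det M ≡ suc zero × ∀ x → lookup v x ≡ x ⋆ M
    tabulated (a ∷ b ∷ c ∷ d ∷ []) = from-yes (all? λ a → all? λ b → all? λ c → all? λ d →
      let f = lookup (a ∷ b ∷ c ∷ d ∷ []) in
      (all? λ x → all? λ y → all? λ z → distinct3? x y z →-dec (g₃ (f x) (f y) (f z) Sign.≟ g₃ x y z))
      →-dec ∃-SL₂? λ M → all? λ x → f x ≟ x ⋆ M) a b c d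

möbius : SL₂𝔽₃ → Aut g₃
möbius (M , det≡1) =
  permutation (_⋆ M) (_⋆ adj M) (λ x → proj₂ (⋆-adj M det≡1 x)) (λ x → proj₁ (⋆-adj M det≡1 x)) ,
  ⋆-endomorphism M det≡1

φ : Aut g₃ → SL₂𝔽₃
φ (π , π-endo) = map₂ proj₁ (endomorphism-möbius (π ⟨$⟩ʳ_) π-endo)

φ-induces : ∀ α x → proj₁ α ⟨$⟩ʳ x ≡ x ⋆ proj₁ (φ α)
φ-induces (π , π-endo) = proj₂ (proj₂ (endomorphism-möbius (π ⟨$⟩ʳ_) π-endo))

⋆-resp-≈± : ∀ {M N} → M ≈± N → ∀ x → x ⋆ M ≡ x ⋆ N
⋆-resp-≈± (inj₁ refl) x = refl
⋆-resp-≈± {N = N} (inj₂ refl) x = ⋆-negM N x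

φ-isoToPSL₂ : IsoToPSL₂𝔽₃ φ
φ-isoToPSL₂ = resp , injective , surjective , homomorphic
  where
  open ≡-Reasoning
  resp : ∀ α β → α ≈Aut β → proj₁ (φ α) ≈± proj₁ (φ β)
  resp α β α≈β = ⋆-kernel (φ α) (φ β) λ x → trans (sym (φ-induces α x)) (trans (α≈β x) (φ-induces β x))
  injective : ∀ α β → proj₁ (φ α) ≈± proj₁ (φ β) → α ≈Aut β
  injective α β φα≈φβ x = trans (φ-induces α x) (trans (⋆-resp-≈± φα≈φβ x) (sym (φ-induces β x)))
  surjective : ∀ M → ∃ λ α → proj₁ (φ α) ≈± proj₁ M
  surjective M = möbius M , ⋆-kernel (φ (möbius M)) M λ x → sym (φ-induces (möbius M) x)
  homomorphic : ∀ α β → proj₁ (φ (α ∘Aut β)) ≈± (proj₁ (φ α) ⊗ proj₁ (φ β))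
  homomorphic α β = ⋆-kernel (φ (α ∘Aut β)) (A ⊗ B , trans (det-⊗ A B) (cong₂ _*₃_ detA detB)) λ x → begin
    x ⋆ proj₁ (φ (α ∘Aut β))          ≡⟨ sym (φ-induces (α ∘Aut β) x) ⟩
    proj₁ β ⟨$⟩ʳ (proj₁ α ⟨$⟩ʳ x)      ≡⟨ φ-induces β _ ⟩
    (proj₁ α ⟨$⟩ʳ x) ⋆ B               ≡⟨ cong (_⋆ B) (φ-induces α x) ⟩
    (x ⋆ A) ⋆ B                        ≡⟨ sym (⋆-⊗ A detA B detB x) ⟩
    x ⋆ (A ⊗ B)                        ∎
    where
    A = proj₁ (φ α)
    B = proj₁ (φ β)
    detA = proj₂ (φ α)
    detB = proj₂ (φ β)

lemma4p6 : Special g₃ × AutIsoPSL₂𝔽₃ g₃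
lemma4p6 = splitting⇒special g₃-splitting , φ , φ-isoToPSL₂
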